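{- Let $d$ and $n$ be positive integers. If the set $\mathrm{NC}^d_n$ is nonempty then $n\equiv1\bmod d$.
   Context: A partition of $[n]$ is noncrossing if there are no $i<j<k<\ell$ with $i,k$ in one block and $j,\ell$ in a different block. The Kreweras dual $\pi'$ of a noncrossing partition $\pi$ of $[n]$: place $1,1',2,2',\dots,n,n'$ on a circle in this cyclic order; $\pi'$ is the coarsest partition of $\{1',\dots,n'\}$ such that the blocks of $\pi$ and of $\pi'$ together form a noncrossing partition of these $2n$ points. $\mathrm{NC}^d_n$ is the set of noncrossing partitions $\pi$ of $[n]$ such that every block of $\pi$ and every block of $\pi'$ has cardinality congruent to $1$ modulo $d$. -}

module Defs where

open import Data.Nat using (ℕ; NonZero)
open import Data.Nat.DivMod using (_%_)
open import Data.Fin using (Fin) renaming (_<_ to _<ᶠ_)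
open import Data.Fin.Properties using (_≟_)
open import Data.Bool using (Bool; true; false)
open import Data.Product using (_×_; _,_; ∃)
open import Data.Sum using (_⊎_; inj₁; inj₂)
open import Data.List using (length; filter; allFin)
open import Relation.Binary.PropositionalEquality using (_≡_)
import Data.Nat.Properties as ℕP

-- A set partition of a set P is represented by a block-labelling h : P → L;
-- two elements lie in the same block iff they have the same label.

Noncrossing : {P L : Set} → (P → P → Set) → (P → L) → Set
Noncrossing {P} _<_ h =
  ∀ (a b c e : P) → a < b → b < c → c < e →
  h a ≡ h c → h b ≡ h e → h a ≡ h b

NC : (n : ℕ) → (Fin n → ℕ) → Set
NC n π = Noncrossing _<ᶠ_ π

-- The 2n points 1,1',2,2',...,n,n': point i is (i , false), point i' is (i , true).
-- Their (linear, cut-open cyclic) order is lexicographic.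
data _<₂_ {n : ℕ} : Fin n × Bool → Fin n × Bool → Set where
  fst< : ∀ {i j s t} → i <ᶠ j → (i , s) <₂ (j , t)
  snd< : ∀ {i} → (i , false) <₂ (i , true)

combine : {n : ℕ} → (Fin n → ℕ) → (Fin n → ℕ) → Fin n × Bool → ℕ ⊎ ℕ
combine π π' (i , false) = inj₁ (π i)
combine π π' (i , true)  = inj₂ (π' i)

IsKrewerasDual : (n : ℕ) → (Fin n → ℕ) → (Fin n → ℕ) → Set
IsKrewerasDual n π π' =
  Noncrossing _<₂_ (combine π π') ×
  (∀ (σ : Fin n → ℕ) → Noncrossing _<₂_ (combine π σ) →
     ∀ i j → σ i ≡ σ j → π' i ≡ π' j)

blockSize : {n : ℕ} → (Fin n → ℕ) → Fin n → ℕ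
blockSize {n} π i = length (filter (λ j → π j ℕP.≟ π i) (allFin n))

AllBlocks1Mod : (d : ℕ) .{{_ : NonZero d}} → {n : ℕ} → (Fin n → ℕ) → Set
AllBlocks1Mod d π = ∀ i → blockSize π i % d ≡ 1 % d

InNCd : (d : ℕ) .{{_ : NonZero d}} → (n : ℕ) → (Fin n → ℕ) → Set
InNCd d n π =
  NC n π × ∃ (λ π' → IsKrewerasDual n π π' × AllBlocks1Mod d π × AllBlocks1Mod d π')

-- Since every block of π has size ≡ 1 (mod d), counting [n] block by block gives
-- n ≡ #blocks(π) (mod d), and likewise n ≡ #blocks(π′); we count blocks of π by their
-- minima and blocks of π′ by their maxima.  Kreweras duality gives
-- #blocks(π) + #blocks(π′) = n + 1: 1 is always a minimum and n′ always a maximum, and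
-- for k < n exactly one of "k+1 is the minimum of its π-block" and "k′ is the maximum of
-- its π′-block" holds.  If neither holds, these two blocks cross.  If both hold, let M be
-- the maximum of the π-block of k+1; noncrossing makes [k+1, M] a union of π-blocks, so
-- joining k′ and M′ keeps π ∪ π′ noncrossing, and maximality of π′ puts k′ and M′ in one
-- block, although k′ is the maximum of its block and k < M.  Hence 2n ≡ n + 1, i.e. n ≡ 1 (mod d).

{-# OPTIONS --safe #-}
module Submission where

open import Defs
open import Data.Nat using (ℕ; NonZero; _<_)
open import Data.Nat.DivMod using (_%_)
open import Data.Fin using (Fin)
open import Data.Product using (∃)
open import Relation.Binary.PropositionalEquality using (_≡_)

open import Data.Nat using (zero; suc; _+_; _*_)
import Data.Nat as ℕ
import Data.Nat.Properties as ℕ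
open import Data.Nat.DivMod using (%-distribˡ-+; %-distribˡ-*; [m+kn]%n≡m%n)
open import Data.Nat.Tactic.RingSolver using (solve-∀)
open import Data.Fin using (zero; suc; toℕ; inject₁; fromℕ; punchIn)
  renaming (_<_ to _<ᶠ_; _≤_ to _≤ᶠ_)
open import Data.Fin.Properties
  using (any?; _≟_; <-cmp; ≤∧≢⇒<; toℕ-inject₁; ≤fromℕ; punchInᵢ≢i)
open import Data.Fin.Induction using (<-wellFounded; >-wellFounded)
open import Data.Bool using (true; false; if_then_else_)
open import Data.Product using (_×_; _,_; proj₁; proj₂)
open import Data.Sum using (_⊎_; inj₁; inj₂; [_,_])
open import Data.Sum.Properties using (inj₁-injective; inj₂-injective)
open import Data.List using (length; filter; tabulate)
open import Data.Empty using (⊥)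
open import Function using (_∘_)
open import Level using (0ℓ)
open import Induction.WellFounded using (WellFounded; Acc; acc)
open import Relation.Binary using (Rel; Trichotomous; tri<; tri≈; tri>)
open import Relation.Binary.Consequences using (tri⇒dec<)
import Relation.Binary.Construct.Flip.EqAndOrd as Flip
open import Relation.Binary.PropositionalEquality
  using (refl; sym; trans; cong; cong₂; module ≡-Reasoning)
open import Relation.Nullary using (¬_; Dec; yes; no; does; contradiction)
open import Relation.Nullary.Decidable using (¬?; _×-dec_)
open import Relation.Unary using (Pred; Decidable)

open import Algebra.Properties.CommutativeMonoid.Sum ℕ.+-0-commutativeMonoid
  using ( sum; sum-syntax; sum-cong-≗; sum-replicate-zero; sum-remove; sum-init-last
        ; ∑-comm; ∑-distrib-+ )
open import Algebra.Properties.Semiring.Sum ℕ.+-*-semiring using (*-distribˡ-sum)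

open ≡-Reasoning

𝟙 : {P : Set} → Dec P → ℕ
𝟙 p = if does p then 1 else 0

𝟙-yes : {P : Set} (p : Dec P) → P → 𝟙 p ≡ 1
𝟙-yes (yes _) _ = refl
𝟙-yes (no ¬x) x = contradiction x ¬x

𝟙-no : {P : Set} (p : Dec P) → ¬ P → 𝟙 p ≡ 0
𝟙-no (yes x) ¬x = contradiction x ¬x
𝟙-no (no _) _ = refl

𝟙-* : {P Q : Set} (p : Dec P) (q : Dec Q) → 𝟙 p * 𝟙 q ≡ 𝟙 (p ×-dec q)
𝟙-* (yes _) q = ℕ.+-identityʳ (𝟙 q)
𝟙-* (no _) q = refl

∑-const-1 : ∀ n → ∑[ i < n ] 1 ≡ n
∑-const-1 zero = refl
∑-const-1 (suc n) = cong suc (∑-const-1 n)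

∑-𝟙-unique : ∀ {n} {P : Pred (Fin n) 0ℓ} (P? : Decidable P) {i₀ : Fin n} →
  P i₀ → (∀ {i} → P i → i ≡ i₀) → ∑[ i < n ] 𝟙 (P? i) ≡ 1
∑-𝟙-unique {suc n} P? {i₀} Pi₀ unique = begin
  ∑[ i < suc n ] 𝟙 (P? i)                        ≡⟨ sum-remove {i = i₀} (𝟙 ∘ P?) ⟩
  𝟙 (P? i₀) + ∑[ j < n ] 𝟙 (P? (punchIn i₀ j))  ≡⟨ cong₂ _+_ (𝟙-yes (P? i₀) Pi₀) (sum-cong-≗ others) ⟩
  1 + ∑[ j < n ] 0                               ≡⟨ cong (1 +_) (sum-replicate-zero n) ⟩
  1                                              ∎
  where
  others : ∀ j → 𝟙 (P? (punchIn i₀ j)) ≡ 0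
  others j = 𝟙-no (P? (punchIn i₀ j)) (punchInᵢ≢i i₀ j ∘ unique)

length-filter-tabulate : ∀ {A : Set} {P : Pred A 0ℓ} (P? : Decidable P)
  {n} (f : Fin n → A) → length (filter P? (tabulate f)) ≡ ∑[ i < n ] 𝟙 (P? (f i))
length-filter-tabulate P? {zero} f = refl
length-filter-tabulate P? {suc n} f with P? (f zero)
... | yes _ = cong suc (length-filter-tabulate P? (f ∘ suc))
... | no _ = length-filter-tabulate P? (f ∘ suc)

blockSize≡∑ : ∀ {n} (h : Fin n → ℕ) i → blockSize h i ≡ ∑[ j < n ] 𝟙 (h j ℕ.≟ h i)
blockSize≡∑ h i = length-filter-tabulate (λ j → h j ℕ.≟ h i) (λ j → j)

module _ {d : ℕ} .{{_ : NonZero d}} where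

  +-cong-% : ∀ {m m′ n n′} → m % d ≡ m′ % d → n % d ≡ n′ % d →
             (m + n) % d ≡ (m′ + n′) % d
  +-cong-% {m} {m′} {n} {n′} m≡m′ n≡n′ = begin
    (m + n) % d                ≡⟨ %-distribˡ-+ m n d ⟩
    (m % d + n % d) % d        ≡⟨ cong₂ (λ x y → (x + y) % d) m≡m′ n≡n′ ⟩
    (m′ % d + n′ % d) % d      ≡⟨ %-distribˡ-+ m′ n′ d ⟨
    (m′ + n′) % d              ∎

  *-congˡ-% : ∀ {m n n′} → n % d ≡ n′ % d → (m * n) % d ≡ (m * n′) % d
  *-congˡ-% {m} {n} {n′} n≡n′ = begin
    (m * n) % d                ≡⟨ %-distribˡ-* m n d ⟩
    (m % d * (n % d)) % d      ≡⟨ cong (λ x → (m % d * x) % d) n≡n′ ⟩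
    (m % d * (n′ % d)) % d     ≡⟨ %-distribˡ-* m n′ d ⟨
    (m * n′) % d               ∎

  ∑-cong-% : ∀ {n} {f g : Fin n → ℕ} → (∀ i → f i % d ≡ g i % d) →
             sum f % d ≡ sum g % d
  ∑-cong-% {zero} _ = refl
  ∑-cong-% {suc n} f≡g = +-cong-% (f≡g zero) (∑-cong-% (f≡g ∘ suc))

-- m * pred d is an additive inverse of m modulo d.
+-cancelˡ-% : ∀ {d} .{{_ : NonZero d}} m {n o} →
              (m + n) % d ≡ (m + o) % d → n % d ≡ o % d
+-cancelˡ-% {d@(suc d′)} m {n} {o} m+n≡m+o = begin
  n % d                      ≡⟨ [m+kn]%n≡m%n n m d ⟨
  (n + m * d) % d            ≡⟨ cong (_% d) (regroup n m d′) ⟩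
  ((m + n) + m * d′) % d     ≡⟨ +-cong-% {m = m + n} {m + o} {m * d′} m+n≡m+o refl ⟩
  ((m + o) + m * d′) % d     ≡⟨ cong (_% d) (regroup o m d′) ⟨
  (o + m * d) % d            ≡⟨ [m+kn]%n≡m%n o m d ⟩
  o % d                      ∎
  where
  regroup : ∀ x m e → x + m * suc e ≡ (m + x) + m * e
  regroup = solve-∀

module Leaders {n : ℕ} {_≺_ : Rel (Fin n) 0ℓ}
  (≺-wellFounded : WellFounded _≺_) (≺-cmp : Trichotomous _≡_ _≺_) (h : Fin n → ℕ) where

  HasPredecessor : Fin n → Set
  HasPredecessor i = ∃ λ j → j ≺ i × h j ≡ h i

  IsLeader : Fin n → Set
  IsLeader i = ¬ HasPredecessor i

  hasPredecessor? : Decidable HasPredecessor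
  hasPredecessor? i = any? λ j → tri⇒dec< ≺-cmp j i ×-dec h j ℕ.≟ h i

  isLeader? : Decidable IsLeader
  isLeader? = ¬? ∘ hasPredecessor?

  leader-acc : ∀ {j} → Acc _≺_ j → ∃ λ i → IsLeader i × h i ≡ h j
  leader-acc {j} (acc rs) with hasPredecessor? j
  ... | no ¬pred = j , ¬pred , refl
  ... | yes (k , k≺j , hk≡hj) with leader-acc (rs k≺j)
  ...   | i , leader , hi≡hk = i , leader , trans hi≡hk hk≡hj

  leader : ∀ j → ∃ λ i → IsLeader i × h i ≡ h j
  leader j = leader-acc (≺-wellFounded j)

  leader-unique : ∀ {i i′} → IsLeader i → IsLeader i′ → h i ≡ h i′ → i ≡ i′
  leader-unique {i} {i′} leader leader′ hi≡hi′ with ≺-cmp i i′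
  ... | tri< i≺i′ _ _ = contradiction (i , i≺i′ , hi≡hi′) leader′
  ... | tri≈ _ i≡i′ _ = i≡i′
  ... | tri> _ _ i′≺i = contradiction (i′ , i′≺i , sym hi≡hi′) leader

  #leaders : ℕ
  #leaders = ∑[ i < n ] 𝟙 (isLeader? i)

  ∑-leader-blockSize : ∑[ i < n ] (𝟙 (isLeader? i) * blockSize h i) ≡ n
  ∑-leader-blockSize = begin
    ∑[ i < n ] (𝟙 (isLeader? i) * blockSize h i)
      ≡⟨ sum-cong-≗ (λ i → cong (𝟙 (isLeader? i) *_) (blockSize≡∑ h i)) ⟩
    ∑[ i < n ] (𝟙 (isLeader? i) * ∑[ j < n ] 𝟙 (h j ℕ.≟ h i))
      ≡⟨ sum-cong-≗ (λ i → *-distribˡ-sum (𝟙 (isLeader? i)) (λ j → 𝟙 (h j ℕ.≟ h i))) ⟩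
    ∑[ i < n ] ∑[ j < n ] (𝟙 (isLeader? i) * 𝟙 (h j ℕ.≟ h i))
      ≡⟨ ∑-comm (λ i j → 𝟙 (isLeader? i) * 𝟙 (h j ℕ.≟ h i)) ⟩
    ∑[ j < n ] ∑[ i < n ] (𝟙 (isLeader? i) * 𝟙 (h j ℕ.≟ h i))
      ≡⟨ sum-cong-≗ (λ j → trans (sum-cong-≗ (λ i → 𝟙-* (isLeader? i) (h j ℕ.≟ h i)))
                                 (one-leader j)) ⟩
    ∑[ j < n ] 1
      ≡⟨ ∑-const-1 n ⟩
    n ∎
    where
    one-leader : ∀ j → ∑[ i < n ] 𝟙 (isLeader? i ×-dec h j ℕ.≟ h i) ≡ 1
    one-leader j with leader j
    ... | i₀ , leader₀ , hi₀≡hj =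
      ∑-𝟙-unique (λ i → isLeader? i ×-dec h j ℕ.≟ h i) (leader₀ , sym hi₀≡hj)
        λ (leader , hj≡hi) → leader-unique leader leader₀ (trans (sym hj≡hi) (sym hi₀≡hj))

  n%d≡#leaders%d : ∀ d .{{_ : NonZero d}} → AllBlocks1Mod d h → n % d ≡ #leaders % d
  n%d≡#leaders%d d blocks1 = begin
    n % d                                               ≡⟨ cong (_% d) ∑-leader-blockSize ⟨
    (∑[ i < n ] (𝟙 (isLeader? i) * blockSize h i)) % d  ≡⟨ ∑-cong-% term ⟩
    #leaders % d                                        ∎
    where
    term : ∀ i → (𝟙 (isLeader? i) * blockSize h i) % d ≡ 𝟙 (isLeader? i) % d
    term i = trans (*-congˡ-% {m = 𝟙 (isLeader? i)} (blocks1 i))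
                   (cong (_% d) (ℕ.*-identityʳ (𝟙 (isLeader? i))))

module Min {n : ℕ} = Leaders {n} <-wellFounded <-cmp
module Max {n : ℕ} = Leaders {n} >-wellFounded (Flip.compare _<ᶠ_ <-cmp)

𝟙-xor : {P Q : Set} (p : Dec P) (q : Dec Q) → (P → ¬ Q) → (¬ P → Q) → 𝟙 p + 𝟙 q ≡ 1
𝟙-xor (yes x) (yes y) P⇒¬Q _ = contradiction y (P⇒¬Q x)
𝟙-xor (yes _) (no _) _ _ = refl
𝟙-xor (no _) (yes _) _ _ = refl
𝟙-xor (no ¬x) (no ¬y) _ ¬P⇒Q = contradiction (¬P⇒Q ¬x) ¬y

module _ {n : ℕ} {π : Fin n → ℕ} (ncπ : NC n π) {L R : Fin n}
  (L-min : Min.IsLeader π L) (R-max : Max.IsLeader π R) (πL≡πR : π L ≡ π R) where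

  hull-closedˡ : ∀ {A C} → L ≤ᶠ C → C ≤ᶠ R → π A ≡ π C → L ≤ᶠ A
  hull-closedˡ {A} {C} L≤C C≤R πA≡πC = ℕ.≮⇒≥ λ A<L → L-min (A , A<L , πA≡πL A<L)
    where
    πA≡πL : A <ᶠ L → π A ≡ π L
    πA≡πL A<L with L ≟ C | C ≟ R
    ... | yes refl | _ = πA≡πC
    ... | no _ | yes refl = trans πA≡πC (sym πL≡πR)
    ... | no L≢C | no C≢R = ncπ A L C R A<L (≤∧≢⇒< L≤C L≢C) (≤∧≢⇒< C≤R C≢R) πA≡πC πL≡πR

  hull-closedʳ : ∀ {A C} → L ≤ᶠ C → C ≤ᶠ R → π A ≡ π C → A ≤ᶠ R
  hull-closedʳ {A} {C} L≤C C≤R πA≡πC = ℕ.≮⇒≥ λ R<A → R-max (A , R<A , πA≡πR R<A)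
    where
    πA≡πR : R <ᶠ A → π A ≡ π R
    πA≡πR R<A with L ≟ C | C ≟ R
    ... | yes refl | _ = trans πA≡πC πL≡πR
    ... | no _ | yes refl = πA≡πC
    ... | no L≢C | no C≢R = trans πA≡πC (trans (sym πL≡πC) πL≡πR)
      where
      πL≡πC : π L ≡ π C
      πL≡πC = ncπ L C R A (≤∧≢⇒< L≤C L≢C) (≤∧≢⇒< C≤R C≢R) R<A πL≡πR (sym πA≡πC)

pairPartition : ∀ {n} → Fin n → Fin n → Fin n → ℕ
pairPartition K M i with i ≟ K | i ≟ M
... | yes _ | _ = 0
... | no _ | yes _ = 0
... | no _ | no _ = suc (toℕ i)

module _ {n : ℕ} (K M : Fin n) where

  pairPartition-endpoint : ∀ {i} → i ≡ K ⊎ i ≡ M → pairPartition K M i ≡ 0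
  pairPartition-endpoint {i} i∈KM with i ≟ K | i ≟ M
  ... | yes _ | _ = refl
  ... | no _ | yes _ = refl
  ... | no i≢K | no i≢M = contradiction i∈KM [ i≢K , i≢M ]

  pairPartition-view : ∀ i → (i ≡ K ⊎ i ≡ M) ⊎ pairPartition K M i ≡ suc (toℕ i)
  pairPartition-view i with i ≟ K | i ≟ M
  ... | yes i≡K | _ = inj₁ (inj₁ i≡K)
  ... | no _ | yes i≡M = inj₁ (inj₂ i≡M)
  ... | no _ | no _ = inj₂ refl

  pairPartition-pair : K <ᶠ M → ∀ {i j} → i <ᶠ j →
                       pairPartition K M i ≡ pairPartition K M j → i ≡ K × j ≡ M
  pairPartition-pair K<M {i} {j} i<j σi≡σj with pairPartition-view i | pairPartition-view j
  ... | inj₂ σi≡ | inj₂ σj≡ =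
    contradiction (ℕ.suc-injective (trans (sym σi≡) (trans σi≡σj σj≡))) (ℕ.<⇒≢ i<j)
  ... | inj₁ i∈KM | inj₂ σj≡
    with () ← trans (sym (pairPartition-endpoint i∈KM)) (trans σi≡σj σj≡)
  ... | inj₂ σi≡ | inj₁ j∈KM
    with () ← trans (sym σi≡) (trans σi≡σj (pairPartition-endpoint j∈KM))
  ... | inj₁ (inj₁ refl) | inj₁ (inj₂ refl) = refl , refl
  ... | inj₁ (inj₁ refl) | inj₁ (inj₁ refl) = contradiction i<j (ℕ.<-irrefl refl)
  ... | inj₁ (inj₂ refl) | inj₁ (inj₂ refl) = contradiction i<j (ℕ.<-irrefl refl)
  ... | inj₁ (inj₂ refl) | inj₁ (inj₁ refl) = contradiction (ℕ.<-trans i<j K<M) (ℕ.<-irrefl refl)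

module _ {n : ℕ} {i j : Fin n} where

  <₂⇒≤ : ∀ {s t} → (i , s) <₂ (j , t) → i ≤ᶠ j
  <₂⇒≤ (fst< i<j) = ℕ.<⇒≤ i<j
  <₂⇒≤ snd< = ℕ.≤-refl

  primed<₂⇒< : ∀ {t} → (i , true) <₂ (j , t) → i <ᶠ j
  primed<₂⇒< (fst< i<j) = i<j

  <₂unprimed⇒< : ∀ {s} → (i , s) <₂ (j , false) → i <ᶠ j
  <₂unprimed⇒< (fst< i<j) = i<j

  ≤⇒<₂primed : i ≤ᶠ j → (i , false) <₂ (j , true)
  ≤⇒<₂primed i≤j with i ≟ j
  ... | yes refl = snd<
  ... | no i≢j = fst< (≤∧≢⇒< i≤j i≢j)

module KrewerasPairing {n : ℕ} {π π′ : Fin n → ℕ}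
  (ncπ : NC n π) (kd : IsKrewerasDual n π π′) {K C : Fin n} (K+1≡C : suc (toℕ K) ≡ toℕ C) where

  K<C : K <ᶠ C
  K<C = ℕ.≤-reflexive K+1≡C

  <C⇒≤K : ∀ {j : Fin n} → j <ᶠ C → j ≤ᶠ K
  <C⇒≤K j<C = ℕ.≤-pred (ℕ.≤-trans j<C (ℕ.≤-reflexive (sym K+1≡C)))

  K<⇒C≤ : ∀ {j : Fin n} → K <ᶠ j → C ≤ᶠ j
  K<⇒C≤ K<j = ℕ.≤-trans (ℕ.≤-reflexive (sym K+1≡C)) K<j

  nonLeaderMin⇒leaderMax : Min.HasPredecessor π C → Max.IsLeader π′ K
  nonLeaderMin⇒leaderMax (p , p<C , πp≡πC) (j , K<j , π′j≡π′K)
    with () ← proj₁ kd (p , false) (K , true) (C , false) (j , true)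
                (≤⇒<₂primed (<C⇒≤K p<C)) (fst< K<C) (≤⇒<₂primed (K<⇒C≤ K<j))
                (cong inj₁ πp≡πC) (cong inj₂ (sym π′j≡π′K))

  pairPartition-noncrossing : ∀ {M : Fin n} → Min.IsLeader π C → Max.IsLeader π M →
    π C ≡ π M → K <ᶠ M → Noncrossing _<₂_ (combine π (pairPartition K M))
  pairPartition-noncrossing {M} C-min M-max πC≡πM K<M = noncrossing
    where
    split-left : ∀ {a c : Fin n} → a ≤ᶠ K → K <ᶠ c → c ≤ᶠ M → π a ≡ π c → ⊥
    split-left a≤K K<c c≤M πa≡πc =
      ℕ.<⇒≱ K<C (ℕ.≤-trans (hull-closedˡ ncπ C-min M-max πC≡πM (K<⇒C≤ K<c) c≤M πa≡πc) a≤K)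

    split-right : ∀ {b e : Fin n} → K <ᶠ b → b ≤ᶠ M → M <ᶠ e → π b ≡ π e → ⊥
    split-right K<b b≤M M<e πb≡πe =
      ℕ.<⇒≱ M<e (hull-closedʳ ncπ C-min M-max πC≡πM (K<⇒C≤ K<b) b≤M (sym πb≡πe))

    pair : ∀ {i j} → i <ᶠ j → pairPartition K M i ≡ pairPartition K M j → i ≡ K × j ≡ M
    pair = pairPartition-pair K M K<M

    noncrossing : Noncrossing _<₂_ (combine π (pairPartition K M))
    noncrossing (a , false) (b , false) (c , false) (e , false) a<b b<c c<e πa≡πc πb≡πe =
      cong inj₁ (ncπ a b c e (<₂unprimed⇒< a<b) (<₂unprimed⇒< b<c) (<₂unprimed⇒< c<e)
                  (inj₁-injective πa≡πc) (inj₁-injective πb≡πe))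
    noncrossing (a , false) (b , true) (c , false) (e , true) a<b b<c c<e πa≡πc σb≡σe
      with pair (ℕ.<-≤-trans (primed<₂⇒< b<c) (<₂⇒≤ c<e)) (inj₂-injective σb≡σe)
    ... | refl , refl = contradiction (inj₁-injective πa≡πc)
                          (split-left (<₂⇒≤ a<b) (primed<₂⇒< b<c) (<₂⇒≤ c<e))
    noncrossing (a , true) (b , false) (c , true) (e , false) a<b b<c c<e σa≡σc πb≡πe
      with pair (ℕ.<-≤-trans (primed<₂⇒< a<b) (<₂⇒≤ b<c)) (inj₂-injective σa≡σc)
    ... | refl , refl = contradiction (inj₁-injective πb≡πe)
                          (split-right (primed<₂⇒< a<b) (<₂⇒≤ b<c) (primed<₂⇒< c<e))
    noncrossing (a , true) (b , true) (c , true) (e , true) a<b b<c c<e σa≡σc σb≡σe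
      with pair (ℕ.<-trans (primed<₂⇒< a<b) (primed<₂⇒< b<c)) (inj₂-injective σa≡σc)
         | pair (ℕ.<-trans (primed<₂⇒< b<c) (primed<₂⇒< c<e)) (inj₂-injective σb≡σe)
    ... | refl , _ | refl , _ = contradiction (primed<₂⇒< a<b) (ℕ.<-irrefl refl)
    noncrossing (_ , false) _ (_ , true) _ _ _ _ () _
    noncrossing (_ , true) _ (_ , false) _ _ _ _ () _
    noncrossing _ (_ , false) _ (_ , true) _ _ _ _ ()
    noncrossing _ (_ , true) _ (_ , false) _ _ _ _ ()

  leaderMin⇒nonLeaderMax : Min.IsLeader π C → Max.HasPredecessor π′ K
  leaderMin⇒nonLeaderMax C-min with Max.leader π C
  ... | M , M-max , πM≡πC =
    M , K<M , sym (proj₂ kd (pairPartition K M) σ-noncrossing K M σK≡σM)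
    where
    K<M : K <ᶠ M
    K<M = ℕ.<-≤-trans K<C (ℕ.≮⇒≥ λ M<C → M-max (C , M<C , sym πM≡πC))
    σ-noncrossing : Noncrossing _<₂_ (combine π (pairPartition K M))
    σ-noncrossing = pairPartition-noncrossing C-min M-max (sym πM≡πC) K<M
    σK≡σM : pairPartition K M K ≡ pairPartition K M M
    σK≡σM = trans (pairPartition-endpoint K M (inj₁ refl))
                  (sym (pairPartition-endpoint K M (inj₂ refl)))

  𝟙-leaderMin+𝟙-leaderMax≡1 : 𝟙 (Min.isLeader? π C) + 𝟙 (Max.isLeader? π′ K) ≡ 1
  𝟙-leaderMin+𝟙-leaderMax≡1 = 𝟙-xor (Min.isLeader? π C) (Max.isLeader? π′ K)
    (λ C-min K-max → K-max (leaderMin⇒nonLeaderMax C-min))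
    (λ ¬C-min predK → ¬C-min (λ predC → nonLeaderMin⇒leaderMax predC predK))

#leadersMin+#leadersMax≡n+1 : ∀ {m} {π π′ : Fin (suc m) → ℕ} →
  NC (suc m) π → IsKrewerasDual (suc m) π π′ → Min.#leaders π + Max.#leaders π′ ≡ suc m + 1
#leadersMin+#leadersMax≡n+1 {m} {π} {π′} ncπ kd = begin
  Min.#leaders π + Max.#leaders π′
    ≡⟨ cong (Min.#leaders π +_) (sum-init-last (𝟙 ∘ Max.isLeader? π′)) ⟩
  (𝟙 (Min.isLeader? π zero) + A) + (B + 𝟙 (Max.isLeader? π′ (fromℕ m)))
    ≡⟨ cong₂ (λ x y → (x + A) + (B + y)) first-isMin last-isMax ⟩
  (1 + A) + (B + 1)
    ≡⟨ regroup A B ⟩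
  suc (A + B) + 1
    ≡⟨ cong (λ x → suc x + 1) A+B≡m ⟩
  suc m + 1 ∎
  where
  A B : ℕ
  A = ∑[ k < m ] 𝟙 (Min.isLeader? π (suc k))
  B = ∑[ k < m ] 𝟙 (Max.isLeader? π′ (inject₁ k))

  first-isMin : 𝟙 (Min.isLeader? π zero) ≡ 1
  first-isMin = 𝟙-yes (Min.isLeader? π zero) λ ()

  last-isMax : 𝟙 (Max.isLeader? π′ (fromℕ m)) ≡ 1
  last-isMax =
    𝟙-yes (Max.isLeader? π′ (fromℕ m)) λ (j , last<j , _) → ℕ.<⇒≱ last<j (≤fromℕ j)

  regroup : ∀ x y → (1 + x) + (y + 1) ≡ suc (x + y) + 1
  regroup = solve-∀

  A+B≡m : A + B ≡ m
  A+B≡m = begin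
    A + B
      ≡⟨ ∑-distrib-+ (𝟙 ∘ Min.isLeader? π ∘ suc) (𝟙 ∘ Max.isLeader? π′ ∘ inject₁) ⟨
    ∑[ k < m ] (𝟙 (Min.isLeader? π (suc k)) + 𝟙 (Max.isLeader? π′ (inject₁ k)))
      ≡⟨ sum-cong-≗ (λ k → KrewerasPairing.𝟙-leaderMin+𝟙-leaderMax≡1 ncπ kd
                             (cong suc (toℕ-inject₁ k))) ⟩
    ∑[ k < m ] 1
      ≡⟨ ∑-const-1 m ⟩
    m ∎

lemma3p2 : (d n : ℕ) .{{_ : NonZero d}} → 0 < n →
    ∃ (λ (π : Fin n → ℕ) → InNCd d n π) → n % d ≡ 1 % d
lemma3p2 d zero () _
lemma3p2 d n@(suc _) _ (π , ncπ , π′ , kd , π-blocks , π′-blocks) = +-cancelˡ-% n (begin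
  (n + n) % d
    ≡⟨ +-cong-% (Min.n%d≡#leaders%d π d π-blocks) (Max.n%d≡#leaders%d π′ d π′-blocks) ⟩
  (Min.#leaders π + Max.#leaders π′) % d
    ≡⟨ cong (_% d) (#leadersMin+#leadersMax≡n+1 ncπ kd) ⟩
  (n + 1) % d ∎)
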